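{- There are only finitely many pairs of integers $(n,s)$ with $n\ge3$ and $0\le s\le n-1$ such that $(2+n)s(1-n+3s)\ge 0$ and $h_+(n,s)=0$ or $h_-(n,s)=0$, where for $\delta\in\{+1,-1\}$, \[ h_{\delta}(n,s) = n^3+(2-9s)n^2+(-7-9s+12s^2)n+6s^2+18s+4 + \delta\bigl(n^2-3(s-2)n-3s-7\bigr)\sqrt{(2+n)s(1-n+3s)}. \] -}

module Defs where

open import Data.Integer using (ℤ; +_; _+_; _-_; _*_; -_; _≤_; -1ℤ; 1ℤ)
open import Data.Product using (_×_)
open import Relation.Binary.PropositionalEquality using (_≡_)

A : ℤ → ℤ → ℤ
A n s = n * n * n + (+ 2 - + 9 * s) * (n * n)
        + (- (+ 7) - + 9 * s + + 12 * (s * s)) * n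
        + + 6 * (s * s) + + 18 * s + + 4

B : ℤ → ℤ → ℤ
B n s = n * n - + 3 * (s - + 2) * n - + 3 * s - + 7

D : ℤ → ℤ → ℤ
D n s = (+ 2 + n) * s * (+ 1 - n + + 3 * s)

-- "x = y * √d" for integers x, y and d ≥ 0, where √d is the nonnegative real
-- square root.  Since √d ≥ 0, x = y√d holds iff x² = y² d and x and y do not
-- have opposite signs (x * y ≥ 0).
EqTimesSqrt : ℤ → ℤ → ℤ → Set
EqTimesSqrt x y d = (x * x ≡ y * y * d) × (+ 0 ≤ x * y)

-- h_δ(n,s) = A + δ B √D = 0   ⇔   A = (-δ B) √D     (for D ≥ 0)
HZero : ℤ → ℤ → ℤ → Set
HZero δ n s = EqTimesSqrt (A n s) (- (δ * B n s)) (D n s)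

{-# OPTIONS --safe #-}
module Submission where

open import Defs
open import Data.Integer using (ℤ; +_; _+_; _-_; _*_; _≤_; -1ℤ; 1ℤ)
open import Data.Product using (_×_; _,_; ∃-syntax)
open import Data.Sum using (_⊎_)
open import Data.List using (List)
open import Data.List.Membership.Propositional using (_∈_)

open import Data.Empty using (⊥)
open import Data.Integer using (-_; ∣_∣; _<_; 0ℤ; +[1+_]; -[1+_]; +≤+; +<+)
open import Data.Integer.Properties
  using ( i-j≡0⇒i≡j; i≡j⇒i-j≡0; i*j≡0⇒i≡0∨j≡0; ∣i∣≡0⇒i≡0; abs-*; ∣i+j∣≤∣i∣+∣j∣
        ; ∣i-j∣≤∣i∣+∣j∣; pos-*; drop‿+<+; +-monoʳ-<; +-identityʳ; *-identityˡ; <⇒≤)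
import Data.Integer.Divisibility.Signed as ℤ∣
open import Data.Integer.Tactic.RingSolver using (solve-∀)
open import Data.List using (map; upTo; cartesianProduct)
open import Data.List.Membership.Propositional.Properties
  using (∈-cartesianProduct⁺; ∈-map⁺; ∈-upTo⁺)
import Data.Nat as ℕ
open ℕ using (ℕ; suc; z≤n; s≤s; NonZero; ≢-nonZero)
import Data.Nat.Coprimality as Coprime
open import Data.Nat.Coprimality using (Coprime; coprime-/gcd; coprime-divisor)
import Data.Nat.Divisibility as ℕ∣
open import Data.Nat.Divisibility using (divides; ∣-refl)
open import Data.Nat.DivMod using (_/_; m/n*n≡m)
open import Data.Nat.GCD using (gcd; gcd[m,n]∣m; gcd[m,n]∣n; gcd[m,n]≢0)
import Data.Nat.Properties as ℕ
import Data.Nat.Tactic.RingSolver as ℕ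
open import Data.Sum using (inj₁; inj₂; [_,_]′)
import Data.Sum as Sum
open import Function using (_∘_; id)
open import Relation.Nullary using (yes; no; contradiction)
open import Relation.Nullary.Decidable using (toWitness)
open import Relation.Binary.PropositionalEquality

-- Both h₊ = 0 and h₋ = 0 give A² = B²D, and −2(A² − B²D) = (n − 1)²(s + 1)·F(n, s) with
-- F = p² + αpq + βq² for certain polynomials p, q = 3(s + 1 − n), α, β in n and s.  On the
-- line q = 0 the form F vanishes only for n ∈ {1, 2}, so for n ≥ 3 the fraction p/q is a
-- rational root of the monic quadratic z² + αz + β, hence an integer z.  With b = z + α, z is
-- also a root of z² + t(b)z + u(b), so 2z + t(b) is a square root of its discriminant
-- Δ(b) = 9b⁴ − 6b³ − 51b² − 36b + 4.  For b ≥ 29 and for b ≤ −12, Δ(b) lies strictly between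
-- Y² and (Y + 1)² with Y = 3b² − b − 9; hence −11 ≤ b ≤ 28, which bounds
-- 4n = (3b − 2)·2z + 4b − 32, and s < n.

i≢0⇒i*j≡0⇒j≡0 : ∀ {i j} → i ≢ 0ℤ → i * j ≡ 0ℤ → j ≡ 0ℤ
i≢0⇒i*j≡0⇒j≡0 {i} i≢0 = [ (λ i≡0 → contradiction i≡0 i≢0) , id ]′ ∘ i*j≡0⇒i≡0∨j≡0 i

i≢0∧j≢0⇒i*j≢0 : ∀ {i j} → i ≢ 0ℤ → j ≢ 0ℤ → i * j ≢ 0ℤ
i≢0∧j≢0⇒i*j≢0 {i} i≢0 j≢0 = [ i≢0 , j≢0 ]′ ∘ i*j≡0⇒i≡0∨j≡0 i

i<i+j : ∀ i {j} → 0ℤ < j → i < i + j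
i<i+j i {j} 0<j = subst (_< i + j) (+-identityʳ i) (+-monoʳ-< i 0<j)

0<c+ax²+bx : ∀ c a b x → 0ℤ < + suc c + (+ a * (+ x * + x) + + b * + x)
0<c+ax²+bx c a b x rewrite sym (pos-* x x) | sym (pos-* a (x ℕ.* x)) | sym (pos-* b x) =
  +<+ (s≤s z≤n)

i*i≡+∣i∣*∣i∣ : ∀ i → i * i ≡ + (∣ i ∣ ℕ.* ∣ i ∣)
i*i≡+∣i∣*∣i∣ (+ m)    = sym (pos-* m m)
i*i≡+∣i∣*∣i∣ -[1+ m ] = refl

∣i∣≤∣i*i∣ : ∀ i → ∣ i ∣ ℕ.≤ ∣ i * i ∣
∣i∣≤∣i*i∣ (+ 0)    = z≤n
∣i∣≤∣i*i∣ +[1+ m ] = ℕ.m≤m*n (suc m) (suc m)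
∣i∣≤∣i*i∣ -[1+ m ] = ℕ.m≤m*n (suc m) (suc m)

∣a*[x-c]+d∣≤ : ∀ a x c d → ∣ a * (x - c) + d ∣ ℕ.≤ ∣ a ∣ ℕ.* (∣ x ∣ ℕ.+ ∣ c ∣) ℕ.+ ∣ d ∣
∣a*[x-c]+d∣≤ a x c d = begin
  ∣ a * (x - c) + d ∣                    ≤⟨ ∣i+j∣≤∣i∣+∣j∣ (a * (x - c)) d ⟩
  ∣ a * (x - c) ∣ ℕ.+ ∣ d ∣              ≡⟨ cong (ℕ._+ ∣ d ∣) (abs-* a (x - c)) ⟩
  ∣ a ∣ ℕ.* ∣ x - c ∣ ℕ.+ ∣ d ∣          ≤⟨ ℕ.+-monoˡ-≤ ∣ d ∣ (ℕ.*-monoʳ-≤ ∣ a ∣ (∣i-j∣≤∣i∣+∣j∣ x c)) ⟩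
  ∣ a ∣ ℕ.* (∣ x ∣ ℕ.+ ∣ c ∣) ℕ.+ ∣ d ∣  ∎
  where open ℕ.≤-Reasoning

no-square-between : ∀ m y → y ℕ.* y ℕ.< m ℕ.* m → m ℕ.* m ℕ.< suc y ℕ.* suc y → ⊥
no-square-between m y y²<m² m²<[1+y]² with m ℕ.≤? y
... | yes m≤y = ℕ.<⇒≱ y²<m² (ℕ.*-mono-≤ m≤y m≤y)
... | no  m≰y = ℕ.<⇒≱ m²<[1+y]² (ℕ.*-mono-≤ (ℕ.≰⇒> m≰y) (ℕ.≰⇒> m≰y))

square-gap : ∀ X {Y d e} → 0ℤ ≤ Y → 0ℤ < d → 0ℤ < e →
             X * X ≡ Y * Y + d → (+ 1 + Y) * (+ 1 + Y) ≡ X * X + e → ⊥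
square-gap X {+ y} _ 0<d 0<e X²≡Y²+d [1+Y]²≡X²+e =
  no-square-between ∣ X ∣ y (drop‿+<+ Y²<X²) (drop‿+<+ X²<[1+Y]²)
  where
  Y²<X² : + (y ℕ.* y) < + (∣ X ∣ ℕ.* ∣ X ∣)
  Y²<X² = subst₂ _<_ (sym (pos-* y y)) (trans (sym X²≡Y²+d) (i*i≡+∣i∣*∣i∣ X)) (i<i+j _ 0<d)
  X²<[1+Y]² : + (∣ X ∣ ℕ.* ∣ X ∣) < + (suc y ℕ.* suc y)
  X²<[1+Y]² = subst₂ _<_ (i*i≡+∣i∣*∣i∣ X) (sym [1+Y]²≡X²+e) (i<i+j _ 0<e)

-- Dividing by g = gcd m n leaves coprime m′, n′ with m′² = n′k′, so n′ = 1.
m*m≡n*k⇒n∣m : ∀ {m n k} → n ≢ 0 → m ℕ.* m ≡ n ℕ.* k → gcd m n ℕ∣.∣ k → n ℕ∣.∣ m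
m*m≡n*k⇒n∣m {m} {n} {k} n≢0 m²≡nk g∣k = divides m′ m≡m′n
  where
  open ≡-Reasoning
  g = gcd m n
  instance
    g≢0 : NonZero g
    g≢0 = ≢-nonZero (gcd[m,n]≢0 m n (inj₂ n≢0))
  m′ = m / g
  n′ = n / g
  k′ = k / g
  m′g≡m : m′ ℕ.* g ≡ m
  m′g≡m = m/n*n≡m (gcd[m,n]∣m m n)
  n′g≡n : n′ ℕ.* g ≡ n
  n′g≡n = m/n*n≡m (gcd[m,n]∣n m n)
  k′g≡k : k′ ℕ.* g ≡ k
  k′g≡k = m/n*n≡m g∣k
  rearrange : ∀ a b c → a ℕ.* b ℕ.* (c ℕ.* c) ≡ (a ℕ.* c) ℕ.* (b ℕ.* c)
  rearrange = ℕ.solve-∀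
  m′²≡n′k′ : m′ ℕ.* m′ ≡ n′ ℕ.* k′
  m′²≡n′k′ = ℕ.*-cancelʳ-≡ _ _ (g ℕ.* g) {{ℕ.m*n≢0 g g}} (begin
    m′ ℕ.* m′ ℕ.* (g ℕ.* g)    ≡⟨ rearrange m′ m′ g ⟩
    m′ ℕ.* g ℕ.* (m′ ℕ.* g)    ≡⟨ cong₂ ℕ._*_ m′g≡m m′g≡m ⟩
    m ℕ.* m                    ≡⟨ m²≡nk ⟩
    n ℕ.* k                    ≡⟨ cong₂ ℕ._*_ n′g≡n k′g≡k ⟨
    n′ ℕ.* g ℕ.* (k′ ℕ.* g)    ≡⟨ rearrange n′ k′ g ⟨
    n′ ℕ.* k′ ℕ.* (g ℕ.* g)    ∎)
  n′≡1 : n′ ≡ 1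
  n′≡1 = coprime (∣-refl , coprime-divisor coprime n′∣m′²)
    where
    coprime : Coprime n′ m′
    coprime = Coprime.sym (coprime-/gcd m n)
    n′∣m′² : n′ ℕ∣.∣ m′ ℕ.* m′
    n′∣m′² = divides k′ (trans m′²≡n′k′ (ℕ.*-comm n′ k′))
  m≡m′n : m ≡ m′ ℕ.* n
  m≡m′n = begin
    m                    ≡⟨ m′g≡m ⟨
    m′ ℕ.* g             ≡⟨ cong (m′ ℕ.*_) (ℕ.*-identityˡ g) ⟨
    m′ ℕ.* (1 ℕ.* g)     ≡⟨ cong (λ c → m′ ℕ.* (c ℕ.* g)) n′≡1 ⟨
    m′ ℕ.* (n′ ℕ.* g)    ≡⟨ cong (m′ ℕ.*_) n′g≡n ⟩
    m′ ℕ.* n             ∎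

monic-quadratic-rational-root : ∀ α β p q → q ≢ 0ℤ → p * p + α * p * q + β * q * q ≡ 0ℤ →
                                ∃[ z ] p ≡ z * q × z * z + α * z + β ≡ 0ℤ
monic-quadratic-rational-root α β p q q≢0 pq-root = z , p≡zq , z-root
  where
  r = - (α * p + β * q)
  expand : ∀ α β p q → p * p - q * - (α * p + β * q) ≡ p * p + α * p * q + β * q * q
  expand = solve-∀
  p²≡qr : p * p ≡ q * r
  p²≡qr = i-j≡0⇒i≡j _ _ (trans (expand α β p q) pq-root)
  g = gcd ∣ p ∣ ∣ q ∣
  g∣p : + g ℤ∣.∣ p
  g∣p = ℤ∣.∣ᵤ⇒∣ (gcd[m,n]∣m ∣ p ∣ ∣ q ∣)
  g∣q : + g ℤ∣.∣ q
  g∣q = ℤ∣.∣ᵤ⇒∣ (gcd[m,n]∣n ∣ p ∣ ∣ q ∣)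
  g∣r : g ℕ∣.∣ ∣ r ∣
  g∣r = ℤ∣.∣⇒∣ᵤ (ℤ∣.∣m⇒∣-m (ℤ∣.∣m∣n⇒∣m+n (ℤ∣.∣n⇒∣m*n α g∣p) (ℤ∣.∣n⇒∣m*n β g∣q)))
  q∣p : q ℤ∣.∣ p
  q∣p = ℤ∣.∣ᵤ⇒∣ (m*m≡n*k⇒n∣m (q≢0 ∘ ∣i∣≡0⇒i≡0)
                  (trans (sym (abs-* p p)) (trans (cong ∣_∣ p²≡qr) (abs-* q r))) g∣r)
  z = ℤ∣.quotient q∣p
  p≡zq : p ≡ z * q
  p≡zq = ℤ∣._∣_.equality q∣p
  factor : ∀ α β q z →
           (z * q) * (z * q) + α * (z * q) * q + β * q * q ≡ q * (q * (z * z + α * z + β))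
  factor = solve-∀
  z-root : z * z + α * z + β ≡ 0ℤ
  z-root = i≢0⇒i*j≡0⇒j≡0 q≢0 (i≢0⇒i*j≡0⇒j≡0 q≢0 (trans (sym (factor α β q z))
             (subst (λ p → p * p + α * p * q + β * q * q ≡ 0ℤ) p≡zq pq-root)))

completing-the-square : ∀ t u z → z * z + t * z + u ≡ 0ℤ →
                        (+ 2 * z + t) * (+ 2 * z + t) ≡ t * t - + 4 * u
completing-the-square t u z root = begin
  (+ 2 * z + t) * (+ 2 * z + t)                  ≡⟨ expand t u z ⟩
  t * t - + 4 * u + + 4 * (z * z + t * z + u)    ≡⟨ cong (λ e → t * t - + 4 * u + + 4 * e) root ⟩
  t * t - + 4 * u + 0ℤ                           ≡⟨ +-identityʳ _ ⟩
  t * t - + 4 * u                                ∎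
  where
  open ≡-Reasoning
  expand : ∀ t u z → (+ 2 * z + t) * (+ 2 * z + t) ≡ t * t - + 4 * u + + 4 * (z * z + t * z + u)
  expand = solve-∀

p q α : ℤ → ℤ → ℤ
p n s = let w = + 1 - n + + 3 * s in + 2 * (w * w) - + 6 * (w * s) - + 16 * w + + 36 * s
q n s = + 3 * (s + + 1 - n)
α n s = + 5 + n - + 3 * s

β : ℤ → ℤ
β s = - (+ 2 * (s + + 1))

F : ℤ → ℤ → ℤ
F n s = p n s * p n s + α n s * p n s * q n s + β s * q n s * q n s

-- solve-∀ does not unfold definitions, so each polynomial identity is proved on the
-- unfolded polynomials (the local lemma `unfolded`).
A²-B²D-factorisation : ∀ n s →
  - (+ 2) * (A n s * A n s - B n s * B n s * D n s) ≡ (n - + 1) * (n - + 1) * (s + + 1) * F n s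
A²-B²D-factorisation = unfolded
  where
  unfolded : ∀ n s →
    let A = n * n * n + (+ 2 - + 9 * s) * (n * n) + (- (+ 7) - + 9 * s + + 12 * (s * s)) * n
            + + 6 * (s * s) + + 18 * s + + 4
        B = n * n - + 3 * (s - + 2) * n - + 3 * s - + 7
        D = (+ 2 + n) * s * (+ 1 - n + + 3 * s)
        w = + 1 - n + + 3 * s
        p = + 2 * (w * w) - + 6 * (w * s) - + 16 * w + + 36 * s
        q = + 3 * (s + + 1 - n)
        α = + 5 + n - + 3 * s
        β = - (+ 2 * (s + + 1))
    in - (+ 2) * (A * A - B * B * D)
       ≡ (n - + 1) * (n - + 1) * (s + + 1) * (p * p + α * p * q + β * q * q)
  unfolded = solve-∀

F-root-on-diagonal : ∀ {n s} → F n s ≡ 0ℤ → q n s ≡ 0ℤ → n ≡ + 1 ⊎ n ≡ + 2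
F-root-on-diagonal {n} {s} F≡0 q≡0 = Sum.map s≡0⇒n≡1 s-1≡0⇒n≡2 (i*j≡0⇒i≡0∨j≡0 s s[s-1]≡0)
  where
  unfolded : ∀ s →
    let n = s + + 1
        w = + 1 - n + + 3 * s
        p = + 2 * (w * w) - + 6 * (w * s) - + 16 * w + + 36 * s
        q = + 3 * (s + + 1 - n)
        α = + 5 + n - + 3 * s
        β = - (+ 2 * (s + + 1))
    in p * p + α * p * q + β * q * q ≡ + 16 * (s * (s - + 1) * (s * (s - + 1)))
  unfolded = solve-∀
  s+1≡n : s + + 1 ≡ n
  s+1≡n = i-j≡0⇒i≡j _ _ (i≢0⇒i*j≡0⇒j≡0 {+ 3} (λ ()) q≡0)
  s[s-1]≡0 : s * (s - + 1) ≡ 0ℤ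
  s[s-1]≡0 = [ id , id ]′ (i*j≡0⇒i≡0∨j≡0 _ (i≢0⇒i*j≡0⇒j≡0 {+ 16} (λ ())
               (trans (sym (unfolded s)) (subst (λ m → F m s ≡ 0ℤ) (sym s+1≡n) F≡0))))
  s≡0⇒n≡1 : s ≡ 0ℤ → n ≡ + 1
  s≡0⇒n≡1 s≡0 = trans (sym s+1≡n) (cong (_+ + 1) s≡0)
  s-1≡0⇒n≡2 : s - + 1 ≡ 0ℤ → n ≡ + 2
  s-1≡0⇒n≡2 s-1≡0 = trans (sym s+1≡n) (cong (_+ + 1) (i-j≡0⇒i≡j s (+ 1) s-1≡0))

t u Δ : ℤ → ℤ
t b = + 10 + b - + 3 * (b * b)
u b = + 24 + + 14 * b - + 2 * (b * b)
Δ b = t b * t b - + 4 * u b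

-- Y = 3b² − b − 9, written in x = b − 29 (resp. x = −12 − b) so that Y and both gaps
-- are polynomials in x with nonnegative coefficients.
Δ-nonsquare⁺ : ∀ x X → X * X ≢ Δ (+ 29 + + x)
Δ-nonsquare⁺ x X X²≡Δ =
  square-gap X (<⇒≤ (0<c+ax²+bx 2484 3 173 x)) (0<c+ax²+bx 38 2 62 x) (0<c+ax²+bx 4931 4 284 x)
    (trans X²≡Δ (Δ≡Y²+d (+ x))) (trans ([1+Y]²≡Δ+e (+ x)) (cong (_+ _) (sym X²≡Δ)))
  where
  Δ≡Y²+d : ∀ x →
    let b = + 29 + x
        Y = + 2485 + (+ 3 * (x * x) + + 173 * x)
        t = + 10 + b - + 3 * (b * b)
        u = + 24 + + 14 * b - + 2 * (b * b)
    in t * t - + 4 * u ≡ Y * Y + (+ 39 + (+ 2 * (x * x) + + 62 * x))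
  Δ≡Y²+d = solve-∀
  [1+Y]²≡Δ+e : ∀ x →
    let b = + 29 + x
        Y = + 2485 + (+ 3 * (x * x) + + 173 * x)
        t = + 10 + b - + 3 * (b * b)
        u = + 24 + + 14 * b - + 2 * (b * b)
    in (+ 1 + Y) * (+ 1 + Y) ≡ t * t - + 4 * u + (+ 4932 + (+ 4 * (x * x) + + 284 * x))
  [1+Y]²≡Δ+e = solve-∀

Δ-nonsquare⁻ : ∀ x X → X * X ≢ Δ (- (+ 12 + + x))
Δ-nonsquare⁻ x X X²≡Δ =
  square-gap X (<⇒≤ (0<c+ax²+bx 434 3 73 x)) (0<c+ax²+bx 858 2 102 x) (0<c+ax²+bx 11 4 44 x)
    (trans X²≡Δ (Δ≡Y²+d (+ x))) (trans ([1+Y]²≡Δ+e (+ x)) (cong (_+ _) (sym X²≡Δ)))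
  where
  Δ≡Y²+d : ∀ x →
    let b = - (+ 12 + x)
        Y = + 435 + (+ 3 * (x * x) + + 73 * x)
        t = + 10 + b - + 3 * (b * b)
        u = + 24 + + 14 * b - + 2 * (b * b)
    in t * t - + 4 * u ≡ Y * Y + (+ 859 + (+ 2 * (x * x) + + 102 * x))
  Δ≡Y²+d = solve-∀
  [1+Y]²≡Δ+e : ∀ x →
    let b = - (+ 12 + x)
        Y = + 435 + (+ 3 * (x * x) + + 73 * x)
        t = + 10 + b - + 3 * (b * b)
        u = + 24 + + 14 * b - + 2 * (b * b)
    in (+ 1 + Y) * (+ 1 + Y) ≡ t * t - + 4 * u + (+ 12 + (+ 4 * (x * x) + + 44 * x))
  [1+Y]²≡Δ+e = solve-∀

n-bound : ℤ → ℕ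
n-bound b = ∣ + 3 * b - + 2 ∣ ℕ.* (∣ Δ b ∣ ℕ.+ ∣ t b ∣) ℕ.+ ∣ + 4 * b - + 32 ∣

-- The maximum of n-bound on −11 ≤ b ≤ 28 is 439644556, at b = 28.
M : ℕ
M = 440000000

Δ-square⇒n-bound≤M : ∀ b X → X * X ≡ Δ b → n-bound b ℕ.≤ M
Δ-square⇒n-bound≤M (+ m) X X²≡Δ with m ℕ.<? 29
... | yes m<29 = toWitness {a? = ℕ.allUpTo? (λ m → n-bound (+ m) ℕ.≤? M) 29} _ m<29
... | no  m≮29 = contradiction
  (subst (λ m → X * X ≡ Δ (+ m)) (sym (ℕ.m+[n∸m]≡n (ℕ.≮⇒≥ m≮29))) X²≡Δ)
  (Δ-nonsquare⁺ (m ℕ.∸ 29) X)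
Δ-square⇒n-bound≤M -[1+ m ] X X²≡Δ with m ℕ.<? 11
... | yes m<11 = toWitness {a? = ℕ.allUpTo? (λ m → n-bound -[1+ m ] ℕ.≤? M) 11} _ m<11
... | no  m≮11 = contradiction
  (subst (λ m → X * X ≡ Δ -[1+ m ]) (sym (ℕ.m+[n∸m]≡n (ℕ.≮⇒≥ m≮11))) X²≡Δ)
  (Δ-nonsquare⁻ (m ℕ.∸ 11) X)

shifted-root : ∀ n s z → p n s ≡ z * q n s → z * z + α n s * z + β s ≡ 0ℤ →
               let b = z + α n s in z * z + t b * z + u b ≡ 0ℤ
shifted-root n s z p≡zq z-root = begin
  z * z + t b * z + u b                    ≡⟨ unfolded n s z ⟩
  (q n s * z - p n s) - + 3 * b * e        ≡⟨ cong₂ (λ p e → (q n s * z - p) - + 3 * b * e) p≡zq z-root ⟩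
  (q n s * z - z * q n s) - + 3 * b * 0ℤ   ≡⟨ cancel (q n s) z (+ 3 * b) ⟩
  0ℤ                                       ∎
  where
  open ≡-Reasoning
  b = z + α n s
  e = z * z + α n s * z + β s
  unfolded : ∀ n s z →
    let w = + 1 - n + + 3 * s
        p = + 2 * (w * w) - + 6 * (w * s) - + 16 * w + + 36 * s
        q = + 3 * (s + + 1 - n)
        α = + 5 + n - + 3 * s
        β = - (+ 2 * (s + + 1))
        b = z + α
    in z * z + (+ 10 + b - + 3 * (b * b)) * z + (+ 24 + + 14 * b - + 2 * (b * b))
       ≡ (q * z - p) - + 3 * b * (z * z + α * z + β)
  unfolded = solve-∀
  cancel : ∀ q z c → (q * z - z * q) - c * 0ℤ ≡ 0ℤ
  cancel = solve-∀

integer-root⇒∣n∣≤M : ∀ n s → ∃[ z ] p n s ≡ z * q n s × z * z + α n s * z + β s ≡ 0ℤ → ∣ n ∣ ℕ.≤ M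
integer-root⇒∣n∣≤M n s (z , p≡zq , z-root) = begin
  ∣ n ∣                                      ≤⟨ ℕ.m≤n*m ∣ n ∣ 4 ⟩
  4 ℕ.* ∣ n ∣                                ≡⟨ abs-* (+ 4) n ⟨
  ∣ + 4 * n ∣                                ≡⟨ cong ∣_∣ 4n≡ ⟩
  ∣ a * (X - t b) + d ∣                      ≤⟨ ∣a*[x-c]+d∣≤ a X (t b) d ⟩
  ∣ a ∣ ℕ.* (∣ X ∣ ℕ.+ ∣ t b ∣) ℕ.+ ∣ d ∣    ≤⟨ ℕ.+-monoˡ-≤ ∣ d ∣ (ℕ.*-monoʳ-≤ ∣ a ∣
                                                  (ℕ.+-monoˡ-≤ ∣ t b ∣ ∣X∣≤∣Δ∣)) ⟩
  n-bound b                                  ≤⟨ Δ-square⇒n-bound≤M b X X²≡Δ ⟩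
  M                                          ∎
  where
  open ℕ.≤-Reasoning
  b = z + α n s
  X = + 2 * z + t b
  a = + 3 * b - + 2
  d = + 4 * b - + 32
  four-n : ∀ n s z →
    let α = + 5 + n - + 3 * s
        β = - (+ 2 * (s + + 1))
        b = z + α
        t = + 10 + b - + 3 * (b * b)
        X = + 2 * z + t
    in + 4 * n ≡ (+ 3 * b - + 2) * (X - t) + (+ 4 * b - + 32) - + 6 * (z * z + α * z + β)
  four-n = solve-∀
  X²≡Δ : X * X ≡ Δ b
  X²≡Δ = completing-the-square (t b) (u b) z (shifted-root n s z p≡zq z-root)
  ∣X∣≤∣Δ∣ : ∣ X ∣ ℕ.≤ ∣ Δ b ∣
  ∣X∣≤∣Δ∣ = subst (∣ X ∣ ℕ.≤_) (cong ∣_∣ X²≡Δ) (∣i∣≤∣i*i∣ X)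
  4n≡ : + 4 * n ≡ a * (X - t b) + d
  4n≡ = trans (four-n n s z) (trans (cong (λ e → a * (X - t b) + d - + 6 * e) z-root) (+-identityʳ _))

A²≡B²D⇒∣n∣≤M : ∀ n s → n ≢ + 1 → n ≢ + 2 → s ≢ -1ℤ →
               A n s * A n s ≡ B n s * B n s * D n s → ∣ n ∣ ℕ.≤ M
A²≡B²D⇒∣n∣≤M n s n≢1 n≢2 s≢-1 A²≡B²D =
  integer-root⇒∣n∣≤M n s (monic-quadratic-rational-root (α n s) (β s) (p n s) (q n s) q≢0 F≡0)
  where
  n-1≢0 : n - + 1 ≢ 0ℤ
  n-1≢0 = n≢1 ∘ i-j≡0⇒i≡j n (+ 1)
  F≡0 : F n s ≡ 0ℤ
  F≡0 = i≢0⇒i*j≡0⇒j≡0 (i≢0∧j≢0⇒i*j≢0 (i≢0∧j≢0⇒i*j≢0 n-1≢0 n-1≢0) (s≢-1 ∘ i-j≡0⇒i≡j s -1ℤ))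
          (trans (sym (A²-B²D-factorisation n s)) (cong (- (+ 2) *_) (i≡j⇒i-j≡0 A²≡B²D)))
  q≢0 : q n s ≢ 0ℤ
  q≢0 = [ n≢1 , n≢2 ]′ ∘ F-root-on-diagonal F≡0

[-δb]²d≡b²d : ∀ δ → δ * δ ≡ 1ℤ → ∀ b d → - (δ * b) * - (δ * b) * d ≡ b * b * d
[-δb]²d≡b²d δ δ²≡1 b d = begin
  - (δ * b) * - (δ * b) * d   ≡⟨ expand δ b d ⟩
  δ * δ * (b * b * d)         ≡⟨ cong (_* (b * b * d)) δ²≡1 ⟩
  1ℤ * (b * b * d)            ≡⟨ *-identityˡ (b * b * d) ⟩
  b * b * d                   ∎
  where
  open ≡-Reasoning
  expand : ∀ δ b d → - (δ * b) * - (δ * b) * d ≡ δ * δ * (b * b * d)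
  expand = solve-∀

HZero±⇒A²≡B²D : ∀ n s → HZero 1ℤ n s ⊎ HZero -1ℤ n s → A n s * A n s ≡ B n s * B n s * D n s
HZero±⇒A²≡B²D n s (inj₁ (A²≡B²D , _)) = trans A²≡B²D ([-δb]²d≡b²d 1ℤ refl (B n s) (D n s))
HZero±⇒A²≡B²D n s (inj₂ (A²≡B²D , _)) = trans A²≡B²D ([-δb]²d≡b²d -1ℤ refl (B n s) (D n s))

box : ℕ → List (ℤ × ℤ)
box N = cartesianProduct (map +_ (upTo (suc N))) (map +_ (upTo (suc N)))

∈-box : ∀ {N m k} → m ℕ.≤ N → k ℕ.≤ N → _∈_ {A = ℤ × ℤ} (+ m , + k) (box N)
∈-box m≤N k≤N = ∈-cartesianProduct⁺ (∈-map⁺ +_ (∈-upTo⁺ (s≤s m≤N))) (∈-map⁺ +_ (∈-upTo⁺ (s≤s k≤N)))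

theorem4p4 : ∃[ L ] ((n s : ℤ) → + 3 ≤ n → + 0 ≤ s → s ≤ n - + 1
    → + 0 ≤ D n s → (HZero 1ℤ n s ⊎ HZero -1ℤ n s)
    → _∈_ {A = ℤ × ℤ} (n , s) L)
theorem4p4 = box M , in-box
  where
  in-box : (n s : ℤ) → + 3 ≤ n → + 0 ≤ s → s ≤ n - + 1
         → + 0 ≤ D n s → (HZero 1ℤ n s ⊎ HZero -1ℤ n s)
         → _∈_ {A = ℤ × ℤ} (n , s) (box M)
  in-box (+ n) (+ s) (+≤+ (s≤s (s≤s (s≤s _)))) (+≤+ _) (+≤+ s≤n-1) _ h =
    ∈-box n≤M (ℕ.≤-trans (ℕ.m≤n⇒m≤1+n s≤n-1) n≤M)
    where
    n≤M : n ℕ.≤ M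
    n≤M = A²≡B²D⇒∣n∣≤M (+ n) (+ s) (λ ()) (λ ()) (λ ()) (HZero±⇒A²≡B²D (+ n) (+ s) h)
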